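{- Let $T_1$ and $T_2$ be switching equivalent tournaments on the same vertex set $V$. Then $T_1$ is a CR tournament if and only if $T_2$ is a CR tournament.
   Context: A tournament is a digraph with exactly one arc between each pair of distinct vertices. For distinct vertices write $\theta_T(u,v)=1$ if $u\to v$, $-1$ otherwise. Skew-adjacency matrix $S_T$: entry $1$ if $v_i\to v_j$, $-1$ if $v_j\to v_i$, $0$ on the diagonal; $\det(T)=\det(S_T)$. For odd $k\ge1$, $\mathcal{D}_k$ is the set of tournaments all of whose induced subtournaments have determinant at most $k^2$; $\mathcal{D}_{ -1}=\emptyset$. The switch of $T$ w.r.t. $W\subseteq V(T)$ reverses all arcs between $W$ and $V(T)\setminus W$; $T$ and its switches are switching equivalent. A diamond is a 4-tournament consisting of a 3-cycle plus a vertex dominating all of it or dominated by all of it. Two vertices $u_1,u_2$ of $T$ are covertices and revertices if $|V(T)|=2$; if $|V(T)|\ge3$ they are covertices if $\theta_T(u_1,v)=\theta_T(u_2,v)$ for all other $v$, revertices if $\theta_T(u_1,v)=-\theta_T(u_2,v)$ for all other $v$; CR-associated if covertices or revertices. For $u\notin V(T)=\{w_1,\dots,w_n\}$ and $\sigma=(r_1,\dots,r_n)\in\{\pm1\}^n$, $T(u,\sigma)$ extends $T$ by $u$ with $u\to w_i$ iff $r_i=1$; $u$ is a CR vertex for $T$ with $\sigma$ if $u$ is CR-associated in $T(u,\sigma)$ with some vertex of $T$, otherwise a non-CR vertex. Let $T\in\mathcal{D}_k\setminus\mathcal{D}_{k-2}$ for some odd $k$. $T$ is a CR tournament if $T$ is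 a 1-tournament, a 2-tournament or a diamond, or else for every $u\notin V(T)$ and every $\sigma$ with $u$ a non-CR vertex for $T$ with $\sigma$, $T(u,\sigma)\notin\mathcal{D}_k$. -}

module Defs where

open import Data.Bool using (Bool; true; false; not; if_then_else_; _xor_)
open import Data.Nat using (ℕ; zero; suc; _*_; _+_)
open import Data.Fin using (Fin; zero; suc; punchIn; toℕ; _<_; _≟_)
open import Data.Integer as ℤ using (ℤ; +_; -_; _≤_)
open import Data.Product using (Σ; ∃; _×_; _,_)
open import Data.Sum using (_⊎_)
open import Data.Unit using (⊤)
open import Relation.Nullary using (¬_; yes; no)
open import Relation.Binary.PropositionalEquality using (_≡_; _≢_)

-- Tournaments on the vertex set Fin n.
-- beats i j = true  means  i → j.  Exactly one arc between distinct vertices.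
-- (The value of beats on the diagonal is irrelevant and never used.)

Arcs : ℕ → Set
Arcs n = Fin n → Fin n → Bool

record Tournament (n : ℕ) : Set where
  field
    beats  : Arcs n
    oneArc : ∀ i j → i ≢ j → beats j i ≡ not (beats i j)
open Tournament public

θ : ∀ {n} → Arcs n → Fin n → Fin n → ℤ
θ A u v = if A u v then + 1 else - (+ 1)

sumFin : ∀ n → (Fin n → ℤ) → ℤ
sumFin zero    f = + 0
sumFin (suc n) f = f zero ℤ.+ sumFin n (λ i → f (suc i))

signℤ : ℕ → ℤ
signℤ zero          = + 1
signℤ (suc zero)    = - (+ 1)
signℤ (suc (suc k)) = signℤ k

det : ∀ n → (Fin n → Fin n → ℤ) → ℤ
det zero    M = + 1
det (suc n) M =
  sumFin (suc n) (λ j → signℤ (toℕ j) ℤ.* M zero j ℤ.*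
                        det n (λ r c → M (suc r) (punchIn j c)))

skew : ∀ {n} → Arcs n → Fin n → Fin n → ℤ
skew A i j with i ≟ j
... | yes _ = + 0
... | no  _ = θ A i j

-- Induced subtournaments: a subset of Fin n with m elements is given by its
-- strictly increasing enumeration f : Fin m → Fin n.

StrictIncr : ∀ {m n} → (Fin m → Fin n) → Set
StrictIncr f = ∀ i j → i < j → f i < f j

detSub : ∀ {m n} → Arcs n → (Fin m → Fin n) → ℤ
detSub {m} A f = det m (skew (λ i j → A (f i) (f j)))

InD : ℕ → ∀ {n} → Arcs n → Set
InD k {n} A = ∀ m (f : Fin m → Fin n) → StrictIncr f → detSub A f ≤ + (k * k)

-- odd k is written k = 2j+1.  Level j A  means  A ∈ D_{2j+1} \ D_{2j-1},
-- with D_{-1} = ∅.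
oddOf : ℕ → ℕ
oddOf j = 2 * j + 1

NotInPrev : ℕ → ∀ {n} → Arcs n → Set
NotInPrev zero    A = ⊤
NotInPrev (suc j) A = ¬ InD (oddOf j) A

Level : ℕ → ∀ {n} → Arcs n → Set
Level j A = InD (oddOf j) A × NotInPrev j A

Covertices : ∀ {n} → Arcs n → Fin n → Fin n → Set
Covertices A u₁ u₂ = ∀ v → v ≢ u₁ → v ≢ u₂ → θ A u₁ v ≡ θ A u₂ v

Revertices : ∀ {n} → Arcs n → Fin n → Fin n → Set
Revertices A u₁ u₂ = ∀ v → v ≢ u₁ → v ≢ u₂ → θ A u₁ v ≡ - θ A u₂ v

CRAssoc : ∀ {n} → Arcs n → Fin n → Fin n → Set
CRAssoc {n} A u₁ u₂ = n ≡ 2 ⊎ Covertices A u₁ u₂ ⊎ Revertices A u₁ u₂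

-- One-vertex extension T(u,σ): the new vertex u is `zero` in Fin (suc n),
-- the old vertex w_i is `suc i`; u → w_i iff σ i = true.

ext : ∀ {n} → Arcs n → (Fin n → Bool) → Arcs (suc n)
ext A σ zero    zero    = false
ext A σ zero    (suc j) = σ j
ext A σ (suc i) zero    = not (σ i)
ext A σ (suc i) (suc j) = A i j

CRVertex : ∀ {n} → Arcs n → (Fin n → Bool) → Set
CRVertex {n} A σ = ∃ λ (w : Fin n) → CRAssoc (ext A σ) zero (suc w)

Diamond : ∀ {n} → Arcs n → Set
Diamond {n} A =
  n ≡ 4 × (∃ λ a → ∃ λ b → ∃ λ c → ∃ λ (d : Fin n) →
    (a ≢ b × a ≢ c × a ≢ d × b ≢ c × b ≢ d × c ≢ d) ×
    (A a b ≡ true × A b c ≡ true × A c a ≡ true) ×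
    ((A d a ≡ true × A d b ≡ true × A d c ≡ true) ⊎
     (A a d ≡ true × A b d ≡ true × A c d ≡ true)))

IsCR : ∀ {n} → Tournament n → Set
IsCR {n} T = ∃ λ j → Level j (beats T) ×
  (n ≡ 1 ⊎ n ≡ 2 ⊎ Diamond (beats T) ⊎
   (∀ (σ : Fin n → Bool) → ¬ CRVertex (beats T) σ →
      ¬ InD (oddOf j) (ext (beats T) σ)))

switchArcs : ∀ {n} → Arcs n → (Fin n → Bool) → Arcs n
switchArcs A W i j = if W i xor W j then not (A i j) else A i j

SwitchingEquivalent : ∀ {n} → Tournament n → Tournament n → Set
SwitchingEquivalent {n} T₁ T₂ =
  ∃ λ (W : Fin n → Bool) → ∀ i j → i ≢ j →
    beats T₂ i j ≡ switchArcs (beats T₁) W i j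

-- Switching with respect to W multiplies the skew-adjacency matrix on both sides by the
-- diagonal matrix of signs sᵥ = ±1 (sᵥ = -1 exactly for v ∈ W); such a conjugation preserves
-- every principal minor, so membership in each 𝒟ₖ is switching invariant.  The same signs
-- turn covertices into covertices or revertices, and switching commutes with adding a vertex
-- u once u's out-arcs σ are switched along.  Finally, a 4-tournament is a diamond exactly when
-- the four rows of its skew-adjacency matrix have the same product (all scores have the same
-- parity), and switching multiplies all four row products by the same sign s_a s_b s_c s_d.

module Submission where

open import Defs
open import Data.Bool using (Bool; true; false; not; if_then_else_; _xor_)
import Data.Bool as Bool
open import Data.Bool.Properties using (not-involutive; ¬-not)
open import Data.Empty using (⊥-elim)
open import Data.Fin using (Fin; zero; suc; punchIn; toℕ; _≟_)
open import Data.Fin.Properties using (<-cmp; <-irrefl)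
open import Data.Integer using (ℤ; +_; -_; _+_; _*_; 0ℤ; 1ℤ; -1ℤ)
import Data.Integer.Properties as ℤ
open import Data.Integer.Tactic.RingSolver using (solve-∀)
open import Data.Nat using (ℕ; zero; suc)
open import Data.Product using (∃; _×_; _,_)
open import Data.Sum using (_⊎_; inj₁; inj₂; map; map₂)
open import Data.Unit using (tt)
open import Data.Vec.Functional using (_∷_)
open import Function.Base using (_∘_)
open import Function.Bundles using (_⇔_; mk⇔)
open import Relation.Binary.Definitions using (tri<; tri≈; tri>)
open import Relation.Binary.PropositionalEquality
open import Relation.Nullary using (¬_; Dec; yes; no; contradiction)
open import Relation.Nullary.Decidable using (_×-dec_)

open import Algebra.Properties.CommutativeMonoid.Sum ℤ.*-1-commutativeMonoid
  using (∑-distrib-+; sum-cong-≗; sum-replicate-zero; sum-remove)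
  renaming (sum to product)

open ≡-Reasoning

private variable
  m n : ℕ
  A A' : Arcs n
  W : Fin n → Bool
  i j u₁ u₂ a b c d v x y z : Fin n

sign : Bool → ℤ
sign false = 1ℤ
sign true  = -1ℤ

sign-squared : ∀ x → sign x * sign x ≡ 1ℤ
sign-squared false = refl
sign-squared true  = refl

sign-xor : ∀ x y → sign (x xor y) ≡ sign x * sign y
sign-xor false false = refl
sign-xor false true  = refl
sign-xor true  false = refl
sign-xor true  true  = refl

*-cancelˡ-unit : ∀ u p q → u * u ≡ 1ℤ → u * p ≡ u * q → p ≡ q
*-cancelˡ-unit u p q u²≡1 up≡uq = begin
  p           ≡⟨ sym (ℤ.*-identityˡ p) ⟩
  1ℤ * p      ≡⟨ cong (_* p) (sym u²≡1) ⟩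
  u * u * p   ≡⟨ ℤ.*-assoc u u p ⟩
  u * (u * p) ≡⟨ cong (u *_) up≡uq ⟩
  u * (u * q) ≡⟨ ℤ.*-assoc u u q ⟨
  u * u * q   ≡⟨ cong (_* q) u²≡1 ⟩
  1ℤ * q      ≡⟨ ℤ.*-identityˡ q ⟩
  q           ∎

sumFin-cong : ∀ n {f g : Fin n → ℤ} → (∀ i → f i ≡ g i) → sumFin n f ≡ sumFin n g
sumFin-cong zero    f≗g = refl
sumFin-cong (suc n) f≗g = cong₂ _+_ (f≗g zero) (sumFin-cong n (f≗g ∘ suc))

*-distribˡ-sumFin : ∀ n x (f : Fin n → ℤ) → x * sumFin n f ≡ sumFin n (λ i → x * f i)
*-distribˡ-sumFin zero    x f = ℤ.*-zeroʳ x
*-distribˡ-sumFin (suc n) x f = begin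
  x * (f zero + sumFin n (f ∘ suc))
    ≡⟨ ℤ.*-distribˡ-+ x (f zero) _ ⟩
  x * f zero + x * sumFin n (f ∘ suc)
    ≡⟨ cong (λ t → x * f zero + t) (*-distribˡ-sumFin n x (f ∘ suc)) ⟩
  x * f zero + sumFin n (λ i → x * f (suc i))
    ∎

det-cong : ∀ n {M N : Fin n → Fin n → ℤ} → (∀ i j → M i j ≡ N i j) → det n M ≡ det n N
det-cong zero    M≗N = refl
det-cong (suc n) M≗N = sumFin-cong (suc n) λ j →
  cong₂ _*_ (cong (signℤ (toℕ j) *_) (M≗N zero j))
            (det-cong n (λ r c → M≗N (suc r) (punchIn j c)))

minor : (Fin (suc n) → Fin (suc n) → ℤ) → Fin (suc n) → Fin n → Fin n → ℤ
minor M j r c = M (suc r) (punchIn j c)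

cofactor-scale : ∀ g x m p d → g * (x * m) * (p * d) ≡ x * p * (g * m * d)
cofactor-scale = solve-∀

det-scaleRows : ∀ n (r : Fin n → ℤ) M → det n (λ i j → r i * M i j) ≡ product r * det n M
det-scaleRows zero    r M = refl
det-scaleRows (suc n) r M = begin
  sumFin (suc n) (λ j → g j * (r zero * M zero j) * det n (λ a c → r (suc a) * minor M j a c))
    ≡⟨ sumFin-cong (suc n) (λ j → cong (g j * (r zero * M zero j) *_)
                                        (det-scaleRows n (r ∘ suc) (minor M j))) ⟩
  sumFin (suc n) (λ j → g j * (r zero * M zero j) * (product (r ∘ suc) * det n (minor M j)))
    ≡⟨ sumFin-cong (suc n) (λ j → cofactor-scale (g j) (r zero) (M zero j)
                                                  (product (r ∘ suc)) (det n (minor M j))) ⟩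
  sumFin (suc n) (λ j → product r * (g j * M zero j * det n (minor M j)))
    ≡⟨ *-distribˡ-sumFin (suc n) (product r) (λ j → g j * M zero j * det n (minor M j)) ⟨
  product r * det (suc n) M ∎
  where
  g : Fin (suc n) → ℤ
  g j = signℤ (toℕ j)

det-scaleColumns : ∀ n (s : Fin n → ℤ) M → det n (λ i j → s j * M i j) ≡ product s * det n M
det-scaleColumns zero    s M = refl
det-scaleColumns (suc n) s M = begin
  sumFin (suc n) (λ j → g j * (s j * M zero j) * det n (λ a c → s (punchIn j c) * minor M j a c))
    ≡⟨ sumFin-cong (suc n) (λ j → cong (g j * (s j * M zero j) *_)
                                        (det-scaleColumns n (s ∘ punchIn j) (minor M j))) ⟩
  sumFin (suc n) (λ j → g j * (s j * M zero j) * (product (s ∘ punchIn j) * det n (minor M j)))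
    ≡⟨ sumFin-cong (suc n) (λ j →
         trans (cofactor-scale (g j) (s j) (M zero j) (product (s ∘ punchIn j)) (det n (minor M j)))
               (cong (_* (g j * M zero j * det n (minor M j))) (sym (sum-remove {i = j} s)))) ⟩
  sumFin (suc n) (λ j → product s * (g j * M zero j * det n (minor M j)))
    ≡⟨ *-distribˡ-sumFin (suc n) (product s) (λ j → g j * M zero j * det n (minor M j)) ⟨
  product s * det (suc n) M ∎
  where
  g : Fin (suc n) → ℤ
  g j = signℤ (toℕ j)

det-conjugate : ∀ n (s : Fin n → ℤ) → (∀ i → s i * s i ≡ 1ℤ) → ∀ M →
                det n (λ i j → s i * (s j * M i j)) ≡ det n M
det-conjugate n s s²≡1 M = begin
  det n (λ i j → s i * (s j * M i j))     ≡⟨ det-scaleRows n s _ ⟩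
  product s * det n (λ i j → s j * M i j) ≡⟨ cong (product s *_) (det-scaleColumns n s M) ⟩
  product s * (product s * det n M)       ≡⟨ ℤ.*-assoc (product s) _ _ ⟨
  product s * product s * det n M         ≡⟨ cong (_* det n M) product²≡1 ⟩
  1ℤ * det n M                            ≡⟨ ℤ.*-identityˡ (det n M) ⟩
  det n M                                 ∎
  where
  product²≡1 : product s * product s ≡ 1ℤ
  product²≡1 = begin
    product s * product s      ≡⟨ ∑-distrib-+ s s ⟨
    product (λ i → s i * s i)  ≡⟨ sum-cong-≗ {n} s²≡1 ⟩
    product {n} (λ _ → 1ℤ)     ≡⟨ sum-replicate-zero n ⟩
    1ℤ                         ∎

record SwitchedBy (A : Arcs n) (W : Fin n → Bool) (A' : Arcs n) : Set where
  constructor switchedBy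
  field arc : ∀ i j → i ≢ j → A' i j ≡ switchArcs A W i j
open SwitchedBy

SwitchedBy-sym : SwitchedBy A W A' → SwitchedBy A' W A
SwitchedBy-sym {A = A} {W = W} sw .arc i j i≢j rewrite sw .arc i j i≢j with W i xor W j
... | true  = sym (not-involutive (A i j))
... | false = refl

θ-switch : SwitchedBy A W A' → i ≢ j → θ A' i j ≡ sign (W i) * (sign (W j) * θ A i j)
θ-switch {A = A} {W = W} {i = i} {j = j} sw i≢j rewrite sw .arc i j i≢j with W i | W j | A i j
... | false | false | false = refl
... | false | false | true  = refl
... | false | true  | false = refl
... | false | true  | true  = refl
... | true  | false | false = refl
... | true  | false | true  = refl
... | true  | true  | false = refl
... | true  | true  | true  = refl

StrictIncr-injective : {f : Fin m → Fin n} → StrictIncr f → i ≢ j → f i ≢ f j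
StrictIncr-injective {i = i} {j = j} f↑ i≢j fi≡fj with <-cmp i j
... | tri< i<j _ _ = <-irrefl fi≡fj (f↑ i j i<j)
... | tri≈ _ i≡j _ = i≢j i≡j
... | tri> _ _ j<i = <-irrefl (sym fi≡fj) (f↑ j i j<i)

skew-switch : SwitchedBy A W A' → (f : Fin m → Fin n) → StrictIncr f → ∀ i j →
  skew (λ i j → A' (f i) (f j)) i j ≡
  sign (W (f i)) * (sign (W (f j)) * skew (λ i j → A (f i) (f j)) i j)
skew-switch {W = W} sw f f↑ i j with i ≟ j
... | yes _  = sym (trans (cong (sign (W (f i)) *_) (ℤ.*-zeroʳ (sign (W (f j)))))
                          (ℤ.*-zeroʳ (sign (W (f i)))))
... | no i≢j = θ-switch sw (StrictIncr-injective f↑ i≢j)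

detSub-switch : SwitchedBy A W A' → {f : Fin m → Fin n} → StrictIncr f → detSub A' f ≡ detSub A f
detSub-switch {W = W} sw {f} f↑ =
  trans (det-cong _ (skew-switch sw f f↑))
        (det-conjugate _ (sign ∘ W ∘ f) (sign-squared ∘ W ∘ f) _)

InD-switch : ∀ {k} → SwitchedBy A W A' → InD k A → InD k A'
InD-switch sw inD m f f↑ = ℤ.≤-trans (ℤ.≤-reflexive (detSub-switch sw f↑)) (inD m f f↑)

Level-switch : ∀ {j} → SwitchedBy A W A' → Level j A → Level j A'
Level-switch {A = A} {A' = A'} {j = j} sw (inD , notInPrev) =
  InD-switch {k = oddOf j} sw inD , NotInPrev-switch j notInPrev
  where
  NotInPrev-switch : ∀ j → NotInPrev j A → NotInPrev j A'
  NotInPrev-switch zero    _          = tt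
  NotInPrev-switch (suc j) ¬inD inD′ = ¬inD (InD-switch {k = oddOf j} (SwitchedBy-sym sw) inD′)

SignedCovertices : Arcs n → Bool → Fin n → Fin n → Set
SignedCovertices A b u₁ u₂ = ∀ v → v ≢ u₁ → v ≢ u₂ → θ A u₁ v ≡ sign b * θ A u₂ v

toSignedCovertices : Covertices A u₁ u₂ ⊎ Revertices A u₁ u₂ → ∃ λ b → SignedCovertices A b u₁ u₂
toSignedCovertices (inj₁ co) = false , λ v p q → trans (co v p q) (sym (ℤ.*-identityˡ _))
toSignedCovertices (inj₂ re) = true  , λ v p q → trans (re v p q) (sym (ℤ.-1*i≡-i _))

fromSignedCovertices : ∀ b → SignedCovertices A b u₁ u₂ → Covertices A u₁ u₂ ⊎ Revertices A u₁ u₂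
fromSignedCovertices false h = inj₁ λ v p q → trans (h v p q) (ℤ.*-identityˡ _)
fromSignedCovertices true  h = inj₂ λ v p q → trans (h v p q) (ℤ.-1*i≡-i _)

SignedCovertices-switch : SwitchedBy A W A' → ∀ b → SignedCovertices A b u₁ u₂ →
                          SignedCovertices A' ((W u₁ xor W u₂) xor b) u₁ u₂
SignedCovertices-switch {A = A} {W = W} {A' = A'} {u₁ = u₁} {u₂ = u₂} sw b h v v≢u₁ v≢u₂ = begin
  θ A' u₁ v
    ≡⟨ θ-switch sw (≢-sym v≢u₁) ⟩
  s₁ * (sᵥ * θ A u₁ v)
    ≡⟨ cong (λ t → s₁ * (sᵥ * t)) (h v v≢u₁ v≢u₂) ⟩
  s₁ * (sᵥ * (sign b * t₂))
    ≡⟨ ℤ.*-identityˡ (s₁ * (sᵥ * (sign b * t₂))) ⟨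
  1ℤ * (s₁ * (sᵥ * (sign b * t₂)))
    ≡⟨ cong (_* (s₁ * (sᵥ * (sign b * t₂)))) (sign-squared (W u₂)) ⟨
  s₂ * s₂ * (s₁ * (sᵥ * (sign b * t₂)))
    ≡⟨ rearrange s₁ s₂ sᵥ (sign b) t₂ ⟩
  s₁ * s₂ * sign b * (s₂ * (sᵥ * t₂))
    ≡⟨ cong₂ _*_ sign-factor (θ-switch sw (≢-sym v≢u₂)) ⟨
  sign ((W u₁ xor W u₂) xor b) * θ A' u₂ v ∎
  where
  s₁ s₂ sᵥ t₂ : ℤ
  s₁ = sign (W u₁)
  s₂ = sign (W u₂)
  sᵥ = sign (W v)
  t₂ = θ A u₂ v
  rearrange : ∀ x y z e t → y * y * (x * (z * (e * t))) ≡ x * y * e * (y * (z * t))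
  rearrange = solve-∀
  sign-factor : sign ((W u₁ xor W u₂) xor b) ≡ s₁ * s₂ * sign b
  sign-factor = trans (sign-xor (W u₁ xor W u₂) b) (cong (_* sign b) (sign-xor (W u₁) (W u₂)))

CRAssoc-switch : SwitchedBy A W A' → CRAssoc A u₁ u₂ → CRAssoc A' u₁ u₂
CRAssoc-switch sw (inj₁ n≡2) = inj₁ n≡2
CRAssoc-switch {W = W} {u₁ = u₁} {u₂ = u₂} sw (inj₂ cr) with toSignedCovertices cr
... | b , h = inj₂ (fromSignedCovertices ((W u₁ xor W u₂) xor b) (SignedCovertices-switch sw b h))

ext-switch : SwitchedBy A W A' → ∀ σ → SwitchedBy (ext A (λ j → W j xor σ j)) (false ∷ W) (ext A' σ)
ext-switch         sw σ .arc zero    zero    0≢0 = ⊥-elim (0≢0 refl)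
ext-switch {W = W} sw σ .arc zero    (suc j) _   with W j
... | false = refl
... | true  = sym (not-involutive (σ j))
ext-switch {W = W} sw σ .arc (suc i) zero    _   with W i
... | false = refl
... | true  = sym (not-involutive (not (σ i)))
ext-switch         sw σ .arc (suc i) (suc j) i≢j = sw .arc i j (i≢j ∘ cong suc)

θ-cong : ∀ (A : Arcs n) → A i j ≡ A x y → θ A i j ≡ θ A x y
θ-cong _ = cong (λ t → if t then 1ℤ else -1ℤ)

θ-injective : ∀ (A : Arcs n) → θ A i j ≡ θ A x y → A i j ≡ A x y
θ-injective {i = i} {j = j} {x = x} {y = y} A eq with A i j | A x y
... | true  | true  = refl
... | false | false = refl
... | true  | false = contradiction eq λ ()
... | false | true  = contradiction eq λ ()

θ-squared : ∀ (A : Arcs n) i j → θ A i j * θ A i j ≡ 1ℤ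
θ-squared A i j with A i j
... | true  = refl
... | false = refl

Distinct4 : Fin n → Fin n → Fin n → Fin n → Set
Distinct4 a b c d = a ≢ b × a ≢ c × a ≢ d × b ≢ c × b ≢ d × c ≢ d

Distinct4-rotate : Distinct4 a b c d → Distinct4 b c d a
Distinct4-rotate (a≢b , a≢c , a≢d , b≢c , b≢d , c≢d) =
  b≢c , b≢d , ≢-sym a≢b , c≢d , ≢-sym a≢c , ≢-sym a≢d

Cyclic : Arcs n → Fin n → Fin n → Fin n → Set
Cyclic A a b c = A a b ≡ A b c × A b c ≡ A c a

Apex : Arcs n → Fin n → Fin n → Fin n → Fin n → Set
Apex A d a b c = A d a ≡ A d b × A d b ≡ A d c

apex? : ∀ (A : Arcs n) d a b c → Dec (Apex A d a b c)
apex? A d a b c = (A d a Bool.≟ A d b) ×-dec (A d b Bool.≟ A d c)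

-- A diamond with apex d, leaving open the orientation of the cycle and whether d
-- dominates it or is dominated by it.
DiamondAt : Arcs n → Fin n → Fin n → Fin n → Fin n → Set
DiamondAt A a b c d = Distinct4 a b c d × Cyclic A a b c × Apex A d a b c

HasDiamond : Arcs n → Set
HasDiamond A = ∃ λ a → ∃ λ b → ∃ λ c → ∃ λ d → DiamondAt A a b c d

rowProduct : Arcs n → Fin n → Fin n → Fin n → Fin n → ℤ
rowProduct A v x y z = θ A v x * θ A v y * θ A v z

rowSum : Arcs n → Fin n → Fin n → Fin n → Fin n → ℤ
rowSum A v x y z = θ A v x + θ A v y + θ A v z

rowProduct-squared : ∀ (A : Arcs n) v x y z → rowProduct A v x y z * rowProduct A v x y z ≡ 1ℤ
rowProduct-squared A v x y z =
  trans (regroup (θ A v x) (θ A v y) (θ A v z))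
        (cong₂ _*_ (cong₂ _*_ (θ-squared A v x) (θ-squared A v y)) (θ-squared A v z))
  where
  regroup : ∀ p q r → p * q * r * (p * q * r) ≡ p * p * (q * q) * (r * r)
  regroup = solve-∀

rowSum-nonApex : ∀ (A : Arcs n) v x y z → ¬ Apex A v x y z →
                 rowSum A v x y z ≡ - rowProduct A v x y z
rowSum-nonApex A v x y z ¬apex with A v x | A v y | A v z
... | true  | true  | true  = contradiction (refl , refl) ¬apex
... | true  | true  | false = refl
... | true  | false | true  = refl
... | true  | false | false = refl
... | false | true  | true  = refl
... | false | true  | false = refl
... | false | false | true  = refl
... | false | false | false = contradiction (refl , refl) ¬apex

-- The row product of v is (-1) to the number of losses of v, so this says that
-- the scores of a, b, c, d inside the quadruple all have the same parity.
record EqualRowProducts (A : Arcs n) (a b c d : Fin n) : Set where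
  constructor rows
  field
    common : ℤ
    row-a  : rowProduct A a b c d ≡ common
    row-b  : rowProduct A b c d a ≡ common
    row-c  : rowProduct A c d a b ≡ common
    row-d  : rowProduct A d a b c ≡ common

EqualRowProducts-rotate : EqualRowProducts A a b c d → EqualRowProducts A b c d a
EqualRowProducts-rotate (rows p ra rb rc rd) = rows p rb rc rd ra

rowProduct-switch : SwitchedBy A W A' → v ≢ x → v ≢ y → v ≢ z →
  rowProduct A' v x y z ≡ sign (W v) * sign (W x) * sign (W y) * sign (W z) * rowProduct A v x y z
rowProduct-switch {A = A} {W = W} {A' = A'} {v = v} {x = x} {y = y} {z = z} sw v≢x v≢y v≢z = begin
  rowProduct A' v x y z
    ≡⟨ cong₂ _*_ (cong₂ _*_ (θ-switch sw v≢x) (θ-switch sw v≢y)) (θ-switch sw v≢z) ⟩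
  sᵥ * (sₓ * θ A v x) * (sᵥ * (s_y * θ A v y)) * (sᵥ * (s_z * θ A v z))
    ≡⟨ regroup sᵥ sₓ s_y s_z (θ A v x) (θ A v y) (θ A v z) ⟩
  sᵥ * sᵥ * (sᵥ * sₓ * s_y * s_z * rowProduct A v x y z)
    ≡⟨ cong (_* (sᵥ * sₓ * s_y * s_z * rowProduct A v x y z)) (sign-squared (W v)) ⟩
  1ℤ * (sᵥ * sₓ * s_y * s_z * rowProduct A v x y z)
    ≡⟨ ℤ.*-identityˡ _ ⟩
  sᵥ * sₓ * s_y * s_z * rowProduct A v x y z ∎
  where
  sᵥ sₓ s_y s_z : ℤ
  sᵥ = sign (W v)
  sₓ = sign (W x)
  s_y = sign (W y)
  s_z = sign (W z)
  regroup : ∀ e f g h p q r →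
    e * (f * p) * (e * (g * q)) * (e * (h * r)) ≡ e * e * (e * f * g * h * (p * q * r))
  regroup = solve-∀

EqualRowProducts-switch : SwitchedBy A W A' → Distinct4 a b c d →
                          EqualRowProducts A a b c d → EqualRowProducts A' a b c d
EqualRowProducts-switch {A = A} {W = W} {A' = A'} {a = a} {b = b} {c = c} {d = d}
  sw (a≢b , a≢c , a≢d , b≢c , b≢d , c≢d) (rows p ra rb rc rd) =
  rows (S * p)
    (row a≢b a≢c a≢d refl ra)
    (row b≢c b≢d (≢-sym a≢b) (sym (rotate sa sb sc sd)) rb)
    (row c≢d (≢-sym a≢c) (≢-sym b≢c) (sym (trans (rotate sa sb sc sd) (rotate sb sc sd sa))) rc)
    (row (≢-sym a≢d) (≢-sym b≢d) (≢-sym c≢d) (rotate sd sa sb sc) rd)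
  where
  sa sb sc sd S : ℤ
  sa = sign (W a)
  sb = sign (W b)
  sc = sign (W c)
  sd = sign (W d)
  S = sa * sb * sc * sd
  rotate : ∀ e f g h → e * f * g * h ≡ f * g * h * e
  rotate = solve-∀
  row : v ≢ x → v ≢ y → v ≢ z → sign (W v) * sign (W x) * sign (W y) * sign (W z) ≡ S →
        rowProduct A v x y z ≡ p → rowProduct A' v x y z ≡ S * p
  row v≢x v≢y v≢z factor≡S r≡p = trans (rowProduct-switch sw v≢x v≢y v≢z) (cong₂ _*_ factor≡S r≡p)

unit-sum-nonzero : ∀ p → p * p ≡ 1ℤ → - p + - p + - p + - p ≢ 0ℤ
unit-sum-nonzero p p²≡1 sum≡0 = contradiction -4≡0 λ ()
  where
  expand : ∀ q → - (+ 4) * (q * q) ≡ q * (- q + - q + - q + - q)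
  expand = solve-∀
  -4≡0 : - (+ 4) ≡ 0ℤ
  -4≡0 = begin
    - (+ 4)                      ≡⟨ cong (- (+ 4) *_) p²≡1 ⟨
    - (+ 4) * (p * p)            ≡⟨ expand p ⟩
    p * (- p + - p + - p + - p)  ≡⟨ cong (p *_) sum≡0 ⟩
    p * 0ℤ                       ≡⟨ ℤ.*-zeroʳ p ⟩
    0ℤ                           ∎

apex-rows : ∀ {x y z w ac ad ba bd cb cd db dc : ℤ} →
  ac ≡ - z → ad ≡ - w → ba ≡ - x → bd ≡ - w → cb ≡ - y → cd ≡ - w → db ≡ w → dc ≡ w →
  x * ac * ad ≡ w * (x * z) × y * bd * ba ≡ w * (x * y) ×
  cd * z * cb ≡ w * (y * z) × w * db * dc ≡ w * (w * w)
apex-rows {x} {y} {z} {w} refl refl refl refl refl refl refl refl =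
  rowA x z w , rowB x y w , rowC y z w , ℤ.*-assoc w w w
  where
  rowA : ∀ x z w → x * - z * - w ≡ w * (x * z)
  rowA = solve-∀
  rowB : ∀ x y w → y * - w * - x ≡ w * (x * y)
  rowB = solve-∀
  rowC : ∀ y z w → - w * z * - y ≡ w * (y * z)
  rowC = solve-∀

skew-rowSums : ∀ {ab ac ad bc bd cd ba ca da cb db dc : ℤ} →
  ba ≡ - ab → ca ≡ - ac → da ≡ - ad → cb ≡ - bc → db ≡ - bd → dc ≡ - cd →
  (ab + ac + ad) + (bc + bd + ba) + (cd + ca + cb) + (da + db + dc) ≡ 0ℤ
skew-rowSums {ab} {ac} {ad} {bc} {bd} {cd} refl refl refl refl refl refl = cancel ab ac ad bc bd cd
  where
  cancel : ∀ ab ac ad bc bd cd →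
    (ab + ac + ad) + (bc + bd + - ab) + (cd + - ac + - bc) + (- ad + - bd + - cd) ≡ 0ℤ
  cancel = solve-∀

units-cyclic : ∀ x y z w → x * x ≡ 1ℤ → y * y ≡ 1ℤ → w * w ≡ 1ℤ →
  w * (x * z) ≡ w * (x * y) → w * (x * y) ≡ w * (y * z) → x ≡ y × y ≡ z
units-cyclic x y z w x²≡1 y²≡1 w²≡1 ra≡rb rb≡rc = trans x≡z z≡y , sym z≡y
  where
  z≡y : z ≡ y
  z≡y = *-cancelˡ-unit x z y x²≡1 (*-cancelˡ-unit w (x * z) (x * y) w²≡1 ra≡rb)
  x≡z : x ≡ z
  x≡z = *-cancelˡ-unit y x z y²≡1
          (trans (ℤ.*-comm y x) (*-cancelˡ-unit w (x * y) (y * z) w²≡1 rb≡rc))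

cyclic-rows : ∀ x y z w → x * x ≡ 1ℤ → w * w ≡ 1ℤ → x ≡ y → y ≡ z →
  w * (x * z) ≡ w × w * (x * y) ≡ w × w * (y * z) ≡ w × w * (w * w) ≡ w
cyclic-rows x _ _ w x²≡1 w²≡1 refl refl =
  absorb x x²≡1 , absorb x x²≡1 , absorb x x²≡1 , absorb w w²≡1
  where
  absorb : ∀ u → u * u ≡ 1ℤ → w * (u * u) ≡ w
  absorb u u²≡1 = trans (cong (w *_) u²≡1) (ℤ.*-identityʳ w)

module _ (T : Tournament n) where

  flip-true : i ≢ j → beats T i j ≡ true → beats T j i ≡ false
  flip-true {i = i} {j = j} i≢j ij = trans (oneArc T i j i≢j) (cong not ij)

  flip-false : i ≢ j → beats T i j ≡ false → beats T j i ≡ true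
  flip-false {i = i} {j = j} i≢j ij = trans (oneArc T i j i≢j) (cong not ij)

  θ-antisym : i ≢ j → θ (beats T) j i ≡ - θ (beats T) i j
  θ-antisym {i = i} {j = j} i≢j rewrite oneArc T i j i≢j with beats T i j
  ... | true  = refl
  ... | false = refl

  rowSums-cancel : Distinct4 a b c d →
    rowSum (beats T) a b c d + rowSum (beats T) b c d a +
    rowSum (beats T) c d a b + rowSum (beats T) d a b c ≡ 0ℤ
  rowSums-cancel (a≢b , a≢c , a≢d , b≢c , b≢d , c≢d) =
    skew-rowSums (θ-antisym a≢b) (θ-antisym a≢c) (θ-antisym a≢d)
                 (θ-antisym b≢c) (θ-antisym b≢d) (θ-antisym c≢d)

  rowProducts-at-apex : Distinct4 a b c d → Apex (beats T) d a b c →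
    let x = θ (beats T) a b; y = θ (beats T) b c; z = θ (beats T) c a; w = θ (beats T) d a in
    rowProduct (beats T) a b c d ≡ w * (x * z) × rowProduct (beats T) b c d a ≡ w * (x * y) ×
    rowProduct (beats T) c d a b ≡ w * (y * z) × rowProduct (beats T) d a b c ≡ w * (w * w)
  rowProducts-at-apex {a = a} {b = b} {c = c} {d = d}
                      (a≢b , a≢c , a≢d , b≢c , b≢d , c≢d) (da≡db , db≡dc) =
    apex-rows (θ-antisym (≢-sym a≢c)) (θ-antisym (≢-sym a≢d)) (θ-antisym a≢b)
              (trans (θ-antisym (≢-sym b≢d)) (cong -_ db≡da)) (θ-antisym b≢c)
              (trans (θ-antisym (≢-sym c≢d)) (cong -_ dc≡da)) db≡da dc≡da
    where
    db≡da : θ (beats T) d b ≡ θ (beats T) d a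
    db≡da = θ-cong (beats T) (sym da≡db)
    dc≡da : θ (beats T) d c ≡ θ (beats T) d a
    dc≡da = θ-cong (beats T) (sym (trans da≡db db≡dc))

  cyclic-of-apex : Distinct4 a b c d → Apex (beats T) d a b c →
                   EqualRowProducts (beats T) a b c d → Cyclic (beats T) a b c
  cyclic-of-apex {a = a} {b = b} {c = c} {d = d} dist apex (rows p ra rb rc _) =
    let (ra′ , rb′ , rc′ , _) = rowProducts-at-apex dist apex
        (x≡y , y≡z) = units-cyclic (θ (beats T) a b) (θ (beats T) b c)
                                   (θ (beats T) c a) (θ (beats T) d a)
                                   (θ-squared (beats T) a b) (θ-squared (beats T) b c)
                                   (θ-squared (beats T) d a)
                                   (trans (sym ra′) (trans ra (trans (sym rb) rb′)))
                                   (trans (sym rb′) (trans rb (trans (sym rc) rc′)))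
    in θ-injective (beats T) x≡y , θ-injective (beats T) y≡z

  EqualRowProducts-of-diamondAt : DiamondAt (beats T) a b c d → EqualRowProducts (beats T) a b c d
  EqualRowProducts-of-diamondAt {a = a} {b = b} {c = c} {d = d} (dist , (ab≡bc , bc≡ca) , apex) =
    let (ra , rb , rc , rd) = rowProducts-at-apex dist apex
        (ea , eb , ec , ed) = cyclic-rows (θ (beats T) a b) (θ (beats T) b c)
                                          (θ (beats T) c a) (θ (beats T) d a)
                                          (θ-squared (beats T) a b) (θ-squared (beats T) d a)
                                          (θ-cong (beats T) ab≡bc) (θ-cong (beats T) bc≡ca)
    in rows (θ (beats T) d a) (trans ra ea) (trans rb eb) (trans rc ec) (trans rd ed)

  -- Without an apex every row sum would be -p (rowSum-nonApex), but the row sums of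
  -- a skew-symmetric matrix add up to 0.
  apex-exists : Distinct4 a b c d → EqualRowProducts (beats T) a b c d →
    Apex (beats T) d a b c ⊎ Apex (beats T) a b c d ⊎
    Apex (beats T) b c d a ⊎ Apex (beats T) c d a b
  apex-exists {a = a} {b = b} {c = c} {d = d} dist (rows p ra rb rc rd)
    with apex? (beats T) d a b c | apex? (beats T) a b c d
       | apex? (beats T) b c d a | apex? (beats T) c d a b
  ... | yes apex | _        | _        | _        = inj₁ apex
  ... | no _     | yes apex | _        | _        = inj₂ (inj₁ apex)
  ... | no _     | no _     | yes apex | _        = inj₂ (inj₂ (inj₁ apex))
  ... | no _     | no _     | no _     | yes apex = inj₂ (inj₂ (inj₂ apex))
  ... | no ¬d    | no ¬a    | no ¬b    | no ¬c    =
    contradiction rowSums≡0 (unit-sum-nonzero p p²≡1)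
    where
    rowSum≡-p : ¬ Apex (beats T) v x y z → rowProduct (beats T) v x y z ≡ p →
                rowSum (beats T) v x y z ≡ - p
    rowSum≡-p ¬apex r≡p = trans (rowSum-nonApex (beats T) _ _ _ _ ¬apex) (cong -_ r≡p)
    rowSums≡0 : - p + - p + - p + - p ≡ 0ℤ
    rowSums≡0 = trans (sym (cong₂ _+_ (cong₂ _+_ (cong₂ _+_ (rowSum≡-p ¬a ra) (rowSum≡-p ¬b rb))
                                                  (rowSum≡-p ¬c rc))
                                      (rowSum≡-p ¬d rd)))
                      (rowSums-cancel dist)
    p²≡1 : p * p ≡ 1ℤ
    p²≡1 = subst (λ q → q * q ≡ 1ℤ) rd (rowProduct-squared (beats T) d a b c)

  diamondAt-of-apex : Distinct4 a b c d → EqualRowProducts (beats T) a b c d →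
                      Apex (beats T) d a b c → DiamondAt (beats T) a b c d
  diamondAt-of-apex dist eq apex = dist , cyclic-of-apex dist apex eq , apex

  HasDiamond-of-EqualRowProducts : Distinct4 a b c d → EqualRowProducts (beats T) a b c d →
                                   HasDiamond (beats T)
  HasDiamond-of-EqualRowProducts {a = a} {b = b} {c = c} {d = d} dist eq =
    pick (apex-exists dist eq)
    where
    dist₁ : Distinct4 b c d a
    dist₁ = Distinct4-rotate dist
    dist₂ : Distinct4 c d a b
    dist₂ = Distinct4-rotate dist₁
    eq₁ : EqualRowProducts (beats T) b c d a
    eq₁ = EqualRowProducts-rotate eq
    eq₂ : EqualRowProducts (beats T) c d a b
    eq₂ = EqualRowProducts-rotate eq₁
    pick : Apex (beats T) d a b c ⊎ Apex (beats T) a b c d ⊎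
           Apex (beats T) b c d a ⊎ Apex (beats T) c d a b → HasDiamond (beats T)
    pick (inj₁ apex)               = a , b , c , d , diamondAt-of-apex dist eq apex
    pick (inj₂ (inj₁ apex))        = b , c , d , a , diamondAt-of-apex dist₁ eq₁ apex
    pick (inj₂ (inj₂ (inj₁ apex))) = c , d , a , b , diamondAt-of-apex dist₂ eq₂ apex
    pick (inj₂ (inj₂ (inj₂ apex))) = d , a , b , c ,
      diamondAt-of-apex (Distinct4-rotate dist₂) (EqualRowProducts-rotate eq₂) apex

  orientation : a ≢ b → a ≢ c → b ≢ c → Cyclic (beats T) a b c →
    (beats T a b ≡ true × beats T b c ≡ true × beats T c a ≡ true) ⊎
    (beats T a c ≡ true × beats T c b ≡ true × beats T b a ≡ true)
  orientation {a = a} {b = b} {c = c} a≢b a≢c b≢c (ab≡bc , bc≡ca) with beats T a b Bool.≟ true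
  ... | yes ab = inj₁ (ab , bc , trans (sym bc≡ca) bc)
    where
    bc : beats T b c ≡ true
    bc = trans (sym ab≡bc) ab
  ... | no ¬ab = inj₂ (flip-false (≢-sym a≢c) ca , flip-false b≢c bc , flip-false a≢b ab)
    where
    ab : beats T a b ≡ false
    ab = ¬-not ¬ab
    bc : beats T b c ≡ false
    bc = trans (sym ab≡bc) ab
    ca : beats T c a ≡ false
    ca = trans (sym bc≡ca) bc

  dominance : a ≢ d → b ≢ d → c ≢ d → Apex (beats T) d a b c →
    (beats T d a ≡ true × beats T d b ≡ true × beats T d c ≡ true) ⊎
    (beats T a d ≡ true × beats T b d ≡ true × beats T c d ≡ true)
  dominance {a = a} {d = d} {b = b} a≢d b≢d c≢d (da≡db , db≡dc) with beats T d a Bool.≟ true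
  ... | yes da = inj₁ (da , db , trans (sym db≡dc) db)
    where
    db : beats T d b ≡ true
    db = trans (sym da≡db) da
  ... | no ¬da = inj₂ (flip-false (≢-sym a≢d) da , flip-false (≢-sym b≢d) db ,
                       flip-false (≢-sym c≢d) (trans (sym db≡dc) db))
    where
    da : beats T d a ≡ false
    da = ¬-not ¬da
    db : beats T d b ≡ false
    db = trans (sym da≡db) da

  HasDiamond-of-Diamond : Diamond (beats T) → n ≡ 4 × HasDiamond (beats T)
  HasDiamond-of-Diamond
    (n≡4 , a , b , c , d , dist@(_ , _ , a≢d , _ , b≢d , c≢d) , (ab , bc , ca) , dom) =
    n≡4 , a , b , c , d , dist , (trans ab (sym bc) , trans bc (sym ca)) , apex dom
    where
    apex : (beats T d a ≡ true × beats T d b ≡ true × beats T d c ≡ true) ⊎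
           (beats T a d ≡ true × beats T b d ≡ true × beats T c d ≡ true) → Apex (beats T) d a b c
    apex (inj₁ (da , db , dc)) = trans da (sym db) , trans db (sym dc)
    apex (inj₂ (ad , bd , cd)) = trans (flip-true a≢d ad) (sym (flip-true b≢d bd)) ,
                                 trans (flip-true b≢d bd) (sym (flip-true c≢d cd))

  Diamond-of-HasDiamond : n ≡ 4 → HasDiamond (beats T) → Diamond (beats T)
  Diamond-of-HasDiamond n≡4
    (a , b , c , d , dist@(a≢b , a≢c , a≢d , b≢c , b≢d , c≢d) , cyclic , apex)
    with orientation a≢b a≢c b≢c cyclic | dominance a≢d b≢d c≢d apex
  ... | inj₁ abc | dom                  = n≡4 , a , b , c , d , dist , abc , dom
  ... | inj₂ acb | inj₁ (da , db , dc) = n≡4 , a , c , b , d , dist′ , acb , inj₁ (da , dc , db)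
    where
    dist′ : Distinct4 a c b d
    dist′ = a≢c , a≢b , a≢d , ≢-sym b≢c , c≢d , b≢d
  ... | inj₂ acb | inj₂ (ad , bd , cd) = n≡4 , a , c , b , d , dist′ , acb , inj₂ (ad , cd , bd)
    where
    dist′ : Distinct4 a c b d
    dist′ = a≢c , a≢b , a≢d , ≢-sym b≢c , c≢d , b≢d

Diamond-switch : (T T' : Tournament n) → SwitchedBy (beats T) W (beats T') →
                 Diamond (beats T) → Diamond (beats T')
Diamond-switch T T' sw diamond =
  let (n≡4 , _ , _ , _ , _ , at@(dist , _)) = HasDiamond-of-Diamond T diamond
  in Diamond-of-HasDiamond T' n≡4
       (HasDiamond-of-EqualRowProducts T' dist
         (EqualRowProducts-switch sw dist (EqualRowProducts-of-diamondAt T at)))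

noNonCRExtension-switch : ∀ {k} → SwitchedBy A W A' →
  (∀ σ → ¬ CRVertex A σ → ¬ InD k (ext A σ)) → (∀ σ → ¬ CRVertex A' σ → ¬ InD k (ext A' σ))
noNonCRExtension-switch {W = W} {k = k} sw noExt σ ¬cr inD =
  noExt (λ j → W j xor σ j) (λ (w , cr) → ¬cr (w , CRAssoc-switch (ext-switch sw σ) cr))
        (InD-switch {k = k} (SwitchedBy-sym (ext-switch sw σ)) inD)

IsCR-switch : (T T' : Tournament n) → SwitchedBy (beats T) W (beats T') → IsCR T → IsCR T'
IsCR-switch T T' sw (j , level , kind) =
  j , Level-switch sw level ,
  map₂ (map₂ (map (Diamond-switch T T' sw) (noNonCRExtension-switch {k = oddOf j} sw))) kind

theorem4p3 : ∀ (n : ℕ) (T₁ T₂ : Tournament n) →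
    SwitchingEquivalent T₁ T₂ → (IsCR T₁ ⇔ IsCR T₂)
theorem4p3 n T₁ T₂ (W , sw) =
  mk⇔ (IsCR-switch T₁ T₂ T₁⇝T₂) (IsCR-switch T₂ T₁ (SwitchedBy-sym T₁⇝T₂))
  where
  T₁⇝T₂ : SwitchedBy (beats T₁) W (beats T₂)
  T₁⇝T₂ = switchedBy sw
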